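{- Let $G$ be a cycle of cliques. Then $Z_+(G)\le |V(G)|-\mathrm{cc}(G)+2$.
   Context: A clique is a set of vertices inducing a complete subgraph; maximal if no vertex can be added. A clique covering is a set of cliques such that every edge lies inside one of them; $\mathrm{cc}(G)$ is its minimum size; a min-max clique covering has size $\mathrm{cc}(G)$ and all cliques maximal. $G$ is a cycle of cliques if it has a min-max clique covering $\{C_1,\dots,C_\ell\}$ such that $C_i\cap C_{i+1}\neq\emptyset$ for $i=1,\dots,\ell-1$ and $C_1\cap C_\ell\neq\emptyset$, while all other intersections of two distinct cliques of the covering are empty. Positive zero forcing: a set $B$ of vertices is coloured black, the rest white; if $W_1,\dots,W_k$ are the vertex sets of the components of $G-B$ ($B$ the current black set), $u\in B$, and $w$ is the only white neighbour of $u$ in $G[W_i\cup B]$, then $w$ may be coloured black. $S$ is a positive zero forcing set if starting from $S$ black all vertices eventually become black; $Z_+(G)$ is the minimum size of such a set. -}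

module Defs where

open import Level using (0ℓ)
open import Data.Nat using (ℕ; zero; suc; _≤_)
open import Data.Fin using (Fin; toℕ; fromℕ)
open import Data.Fin.Subset using (Subset; _∈_; _∉_; _∩_; _∪_; ⁅_⁆; ⊤; ∣_∣; Nonempty; Empty)
open import Data.Product using (Σ; _×_; ∃; ∃-syntax)
open import Data.Sum using (_⊎_)
open import Relation.Nullary using (¬_)
open import Relation.Binary.PropositionalEquality using (_≡_; _≢_)
open import Relation.Binary.Construct.Closure.ReflexiveTransitive using (Star)

record Graph (n : ℕ) : Set₁ where
  field
    Adj     : Fin n → Fin n → Set
    sym     : ∀ {u v} → Adj u v → Adj v u
    irrefl  : ∀ {u} → ¬ Adj u u
open Graph public

module _ {n : ℕ} (G : Graph n) where

  IsClique : Subset n → Set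
  IsClique C = ∀ u v → u ∈ C → v ∈ C → u ≢ v → Adj G u v

  IsMaximalClique : Subset n → Set
  IsMaximalClique C = IsClique C × (∀ w → w ∉ C → ¬ IsClique (C ∪ ⁅ w ⁆))

  IsCliqueCovering : (k : ℕ) → (Fin k → Subset n) → Set
  IsCliqueCovering k C =
    (∀ i → IsClique (C i)) ×
    (∀ u v → Adj G u v → ∃[ i ] (u ∈ C i × v ∈ C i))

  IsCC : ℕ → Set
  IsCC k =
    (Σ (Fin k → Subset n) λ C → IsCliqueCovering k C) ×
    (∀ k' (C : Fin k' → Subset n) → IsCliqueCovering k' C → k ≤ k')

  IsMinMaxCliqueCovering : (k : ℕ) → (Fin k → Subset n) → Set
  IsMinMaxCliqueCovering k C =
    IsCC k × IsCliqueCovering k C × (∀ i → IsMaximalClique (C i))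

  -- Cyclic successor relation on the indices 1..ℓ (here 0..m, ℓ = m+1).
  CycNext : {m : ℕ} → Fin (suc m) → Fin (suc m) → Set
  CycNext {m} i j = (toℕ j ≡ suc (toℕ i)) ⊎ ((toℕ i ≡ m) × (toℕ j ≡ 0))

  IsCycleOfCliques : Set
  IsCycleOfCliques =
    Σ ℕ λ m → Σ (Fin (suc m) → Subset n) λ C →
      IsMinMaxCliqueCovering (suc m) C ×
      (∀ i j → toℕ j ≡ suc (toℕ i) → Nonempty (C i ∩ C j)) ×
      Nonempty (C Data.Fin.zero ∩ C (fromℕ m)) ×
      (∀ i j → i ≢ j → ¬ CycNext i j → ¬ CycNext j i → Empty (C i ∩ C j))

  WhiteEdge : Subset n → Fin n → Fin n → Set
  WhiteEdge B a b = a ∉ B × b ∉ B × Adj G a b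

  SameWhiteComponent : Subset n → Fin n → Fin n → Set
  SameWhiteComponent B x y = x ∉ B × Star (WhiteEdge B) x y

  -- u ∈ B forces w: w is the only white neighbour of u in G[W ∪ B],
  -- W the component of G - B containing w.
  Forces : Subset n → Fin n → Fin n → Set
  Forces B u w =
    u ∈ B × w ∉ B × Adj G u w ×
    (∀ w' → w' ∉ B → Adj G u w' → SameWhiteComponent B w w' → w' ≡ w)

  PZFStep : Subset n → Subset n → Set
  PZFStep B B' = Σ (Fin n) λ u → Σ (Fin n) λ w → Forces B u w × B' ≡ B ∪ ⁅ w ⁆

  IsPZFSet : Subset n → Set
  IsPZFSet S = Star PZFStep S ⊤

  IsZplus : ℕ → Set
  IsZplus z =
    (Σ (Subset n) λ S → IsPZFSet S × ∣ S ∣ ≡ z) ×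
    (∀ S → IsPZFSet S → z ≤ ∣ S ∣)

-- The junctions x₀, …, x_{ℓ-2}, with x_a ∈ C_a ∩ C_{a+1}, of a cycle of ℓ ≥ 4 cliques form an
-- induced path: x_a lies in no clique other than C_a and C_{a+1}, and any edge lies in some C_t.
-- If x₀ is black and the rest of the path white, x₀ has the single white neighbour x₁ and
-- forces it, after which x₁ forces x₂, and so on.  So colouring everything except
-- x₁, …, x_{ℓ-2} black gives a positive zero forcing set of size |V| - ℓ + 2, while ℓ ≥ cc(G).
-- For ℓ ≤ 3 a single edge u v (which exists as cc(G) ≥ 1) does the job: V ∖ {v} is forcing.
module Submission where

open import Defs hiding (sym)
open import Data.Nat using (ℕ; zero; suc; _+_; _≤_; _<_; s≤s; z≤n)
open import Data.Nat.Properties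
  using (≤-refl; ≤-trans; ≤-reflexive; ≤-antisym; n≤1+n; n≮n; <⇒≱; m≤m+n; +-suc; +-comm; +-mono-≤; +-monoʳ-≤; module ≤-Reasoning)
  renaming (_≟_ to _≟ℕ_)
open import Data.Fin using (Fin; toℕ; inject₁) renaming (zero to fzero; suc to fsuc)
open import Data.Fin.Properties using (toℕ-injective; toℕ-inject₁; toℕ<n; suc-injective; any?)
  renaming (_≟_ to _≟F_)
open import Data.Fin.Subset using (Subset; _∈_; _∉_; _∩_; _∪_; ⁅_⁆; ⊤; ⊥; ∣_∣; ∁; Nonempty; Empty; _⊆_)
open import Data.Fin.Subset.Properties
  using (_∈?_; ⊆-antisym; ∪-identityʳ; x∈⁅x⁆; x∈⁅y⁆⇒x≡y; x∈p∩q⁺; x∈p∩q⁻; x∈p∪q⁺; x∈p∪q⁻;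
         ∉⊥; x∈p⇒x∉∁p; x∈∁p⇒x∉p; x∉∁p⇒x∈p; x∉p⇒x∈∁p; ∣⊤∣≡n; ∪-∩-booleanAlgebra)
open import Algebra.Lattice.Properties.BooleanAlgebra using (¬⊥≈⊤)
open import Data.Bool using (true; false)
open import Data.Vec using (_∷_; here; there)
import Data.Vec.Functional as Vector
open import Data.Product using (_×_; _,_; proj₁; proj₂; ∃; ∃₂; ∃-syntax)
open import Data.Sum using (_⊎_; inj₁; inj₂; [_,_])
open import Data.Empty using (⊥-elim)
open import Function using (_∘_; case_of_)
open import Function.Definitions using (Injective)
open import Relation.Nullary using (¬_; Dec; yes; no; ¬?)
open import Relation.Nullary.Decidable using (_×-dec_; _⊎-dec_)
open import Relation.Binary.PropositionalEquality using (_≡_; _≢_; refl; sym; trans; cong; subst; module ≡-Reasoning)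
open import Relation.Binary.Construct.Closure.ReflexiveTransitive using (ε; _◅_)

∣p∪⁅x⁆∣≡1+∣p∣ : ∀ {n} (p : Subset n) {x : Fin n} → x ∉ p → ∣ p ∪ ⁅ x ⁆ ∣ ≡ suc ∣ p ∣
∣p∪⁅x⁆∣≡1+∣p∣ (false ∷ p) {fzero}  x∉p = cong suc (cong ∣_∣ (∪-identityʳ p))
∣p∪⁅x⁆∣≡1+∣p∣ (true  ∷ p) {fzero}  x∉p = ⊥-elim (x∉p here)
∣p∪⁅x⁆∣≡1+∣p∣ (false ∷ p) {fsuc x} x∉p = ∣p∪⁅x⁆∣≡1+∣p∣ p (x∉p ∘ there)
∣p∪⁅x⁆∣≡1+∣p∣ (true  ∷ p) {fsuc x} x∉p = cong suc (∣p∪⁅x⁆∣≡1+∣p∣ p (x∉p ∘ there))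

∁[⁅x⁆∪p]∪⁅x⁆≡∁p : ∀ {n} {x : Fin n} {p : Subset n} → x ∉ p → ∁ (⁅ x ⁆ ∪ p) ∪ ⁅ x ⁆ ≡ ∁ p
∁[⁅x⁆∪p]∪⁅x⁆≡∁p {x = x} {p} x∉p = ⊆-antisym ⊆∁p ∁p⊆
  where
  ⊆∁p : ∁ (⁅ x ⁆ ∪ p) ∪ ⁅ x ⁆ ⊆ ∁ p
  ⊆∁p y∈ with x∈p∪q⁻ (∁ (⁅ x ⁆ ∪ p)) ⁅ x ⁆ y∈
  ... | inj₁ y∈∁ = x∉p⇒x∈∁p (x∈∁p⇒x∉p y∈∁ ∘ x∈p∪q⁺ ∘ inj₂)
  ... | inj₂ y∈⁅x⁆ = subst (_∈ ∁ p) (sym (x∈⁅y⁆⇒x≡y x y∈⁅x⁆)) (x∉p⇒x∈∁p x∉p)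
  ∁p⊆ : ∁ p ⊆ ∁ (⁅ x ⁆ ∪ p) ∪ ⁅ x ⁆
  ∁p⊆ {y} y∈∁p with y ∈? ⁅ x ⁆
  ... | yes y∈⁅x⁆ = x∈p∪q⁺ (inj₂ y∈⁅x⁆)
  ... | no  y∉⁅x⁆ =
    x∈p∪q⁺ (inj₁ (x∉p⇒x∈∁p ([ y∉⁅x⁆ , x∈∁p⇒x∉p y∈∁p ] ∘ x∈p∪q⁻ ⁅ x ⁆ p)))

∁⊥≡⊤ : ∀ {n} → ∁ ⊥ ≡ ⊤ {n}
∁⊥≡⊤ {n} = ¬⊥≈⊤ (∪-∩-booleanAlgebra n)

image : ∀ {p n} → (Fin p → Fin n) → Subset n
image {zero}  x = ⊥
image {suc p} x = ⁅ x fzero ⁆ ∪ image (x ∘ fsuc)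

∈-image⁺ : ∀ {p n} (x : Fin p → Fin n) i → x i ∈ image x
∈-image⁺ x fzero    = x∈p∪q⁺ (inj₁ (x∈⁅x⁆ (x fzero)))
∈-image⁺ x (fsuc i) = x∈p∪q⁺ (inj₂ (∈-image⁺ (x ∘ fsuc) i))

∈-image⁻ : ∀ {p n} (x : Fin p → Fin n) {v} → v ∈ image x → ∃[ i ] v ≡ x i
∈-image⁻ {zero}  x v∈ = ⊥-elim (∉⊥ v∈)
∈-image⁻ {suc p} x v∈ with x∈p∪q⁻ ⁅ x fzero ⁆ (image (x ∘ fsuc)) v∈
... | inj₁ v∈⁅x₀⁆ = fzero , x∈⁅y⁆⇒x≡y _ v∈⁅x₀⁆
... | inj₂ v∈rest = let i , v≡ = ∈-image⁻ (x ∘ fsuc) v∈rest in fsuc i , v≡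

module _ {n} (G : Graph n) where

  record IsInducedPath {p} (x : Fin p → Fin n) : Set where
    field
      injective : Injective _≡_ _≡_ x
      adjacent  : ∀ {a b} → toℕ b ≡ suc (toℕ a) → Adj G (x a) (x b)
      chordless : ∀ {a b} → 2 + toℕ a ≤ toℕ b → ¬ Adj G (x a) (x b)

  open IsInducedPath

  tail-isInducedPath : ∀ {p} {x : Fin (suc p) → Fin n} → IsInducedPath x → IsInducedPath (x ∘ fsuc)
  tail-isInducedPath path = record
    { injective = λ e → suc-injective (injective path e)
    ; adjacent  = λ e → adjacent path (cong suc e)
    ; chordless = λ le → chordless path (s≤s le)
    }

  edge-isInducedPath : ∀ {u v} → Adj G u v → IsInducedPath (u Vector.∷ v Vector.∷ Vector.[])
  edge-isInducedPath {u} {v} uv = record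
    { injective = injective′
    ; adjacent  = adjacent′
    ; chordless = λ {a} {b} 2+a≤b _ → <⇒≱ (toℕ<n b) (≤-trans (m≤m+n 2 (toℕ a)) 2+a≤b)
    }
    where
    x : Fin 2 → Fin n
    x = u Vector.∷ v Vector.∷ Vector.[]
    injective′ : Injective _≡_ _≡_ x
    injective′ {fzero}      {fzero}      _   = refl
    injective′ {fzero}      {fsuc fzero} u≡v = ⊥-elim (irrefl G (subst (Adj G u) (sym u≡v) uv))
    injective′ {fsuc fzero} {fzero}      v≡u = ⊥-elim (irrefl G (subst (Adj G u) v≡u uv))
    injective′ {fsuc fzero} {fsuc fzero} _   = refl
    adjacent′ : ∀ {a b} → toℕ b ≡ suc (toℕ a) → Adj G (x a) (x b)
    adjacent′ {fzero} {fsuc fzero} refl = uv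

  cliqueCovering-edge : ∀ {k} {C : Fin k → Subset n} → IsCliqueCovering G k C →
    ¬ IsCliqueCovering G 0 (λ ()) → ∃₂ λ u v → Adj G u v
  cliqueCovering-edge {C = C} (cliques , covers) ¬covering₀
    with any? (λ i → any? (λ u → any? (λ v → (u ∈? C i) ×-dec (v ∈? C i) ×-dec ¬? (u ≟F v))))
  ... | yes (i , u , v , u∈ , v∈ , u≢v) = u , v , cliques i u v u∈ v∈ u≢v
  ... | no noTwoInOneClique = ⊥-elim (¬covering₀ ((λ ()) , λ u v uv →
          let i , u∈ , v∈ = covers u v uv in
          ⊥-elim (noTwoInOneClique (i , u , v , u∈ , v∈ , λ { refl → irrefl G uv }))))

  module _ {p} {x : Fin (suc (suc p)) → Fin n} (path : IsInducedPath x) where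

    -- x₀ has no white neighbour but x₁ in all of G.
    head-forces : Forces G (∁ (image (x ∘ fsuc))) (x fzero) (x (fsuc fzero))
    head-forces =
        x∉p⇒x∈∁p (λ x₀∈ → let i , x₀≡ = ∈-image⁻ (x ∘ fsuc) x₀∈ in case injective path x₀≡ of λ ())
      , x∈p⇒x∉∁p (∈-image⁺ (x ∘ fsuc) fzero)
      , adjacent path refl
      , λ w w∉ x₀w _ → onlyWhiteNeighbour (∈-image⁻ (x ∘ fsuc) (x∉∁p⇒x∈p w∉)) x₀w
      where
      onlyWhiteNeighbour : ∀ {w} → ∃[ i ] w ≡ x (fsuc i) → Adj G (x fzero) w → w ≡ x (fsuc fzero)
      onlyWhiteNeighbour (fzero  , w≡) _   = w≡
      onlyWhiteNeighbour (fsuc i , refl) x₀w = ⊥-elim (chordless path (s≤s (s≤s z≤n)) x₀w)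

    head-blackened : ∁ (image (x ∘ fsuc)) ∪ ⁅ x (fsuc fzero) ⁆ ≡ ∁ (image (x ∘ fsuc ∘ fsuc))
    head-blackened = ∁[⁅x⁆∪p]∪⁅x⁆≡∁p λ x₁∈ →
      let i , x₁≡ = ∈-image⁻ (x ∘ fsuc ∘ fsuc) x₁∈ in case injective path x₁≡ of λ ()

  inducedPath-zeroForcing : ∀ {p} {x : Fin (suc p) → Fin n} → IsInducedPath x →
    IsPZFSet G (∁ (image (x ∘ fsuc))) × ∣ ∁ (image (x ∘ fsuc)) ∣ + p ≡ n
  inducedPath-zeroForcing {zero} _ rewrite ∁⊥≡⊤ {n} = ε , trans (+-comm _ 0) (∣⊤∣≡n n)
  inducedPath-zeroForcing {suc p} {x} path
    with inducedPath-zeroForcing (tail-isInducedPath path)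
  ... | forcing′ , size′ =
      (x fzero , x (fsuc fzero) , head-forces path , sym (head-blackened path)) ◅ forcing′
    , (begin
        ∣ B ∣ + suc p                  ≡⟨ +-suc ∣ B ∣ p ⟩
        suc ∣ B ∣ + p                  ≡⟨ cong (_+ p) (∣p∪⁅x⁆∣≡1+∣p∣ B x₁∉B) ⟨
        ∣ B ∪ ⁅ x (fsuc fzero) ⁆ ∣ + p ≡⟨ cong (λ S → ∣ S ∣ + p) (head-blackened path) ⟩
        ∣ B′ ∣ + p                     ≡⟨ size′ ⟩
        n                              ∎)
    where
    open ≡-Reasoning
    B B′ : Subset n
    B  = ∁ (image (x ∘ fsuc))
    B′ = ∁ (image (x ∘ fsuc ∘ fsuc))
    x₁∉B : x (fsuc fzero) ∉ B
    x₁∉B = x∈p⇒x∉∁p (∈-image⁺ (x ∘ fsuc) fzero)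

data CyclicNeighbours (m : ℕ) : ℕ → ℕ → Set where
  same        : ∀ {i} → CyclicNeighbours m i i
  successor   : ∀ {i} → CyclicNeighbours m i (suc i)
  predecessor : ∀ {i} → CyclicNeighbours m (suc i) i
  last→first  : CyclicNeighbours m m 0
  first→last  : CyclicNeighbours m 0 m

cyclicNeighbours-sym : ∀ {m i j} → CyclicNeighbours m i j → CyclicNeighbours m j i
cyclicNeighbours-sym same        = same
cyclicNeighbours-sym successor   = predecessor
cyclicNeighbours-sym predecessor = successor
cyclicNeighbours-sym last→first  = first→last
cyclicNeighbours-sym first→last  = last→first

-- With m = 2 the third position 0 would neighbour both 1 and 2.
commonNeighbour-consecutive : ∀ {m a t} → 3 ≤ m → a < m →
  CyclicNeighbours m a t → CyclicNeighbours m (suc a) t → a ≤ t × t ≤ suc a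
commonNeighbour-consecutive _ _ same _ = ≤-refl , n≤1+n _
commonNeighbour-consecutive _ _ successor _ = n≤1+n _ , ≤-refl
commonNeighbour-consecutive (s≤s (s≤s ())) _ predecessor last→first
commonNeighbour-consecutive {m} _ a<m last→first _ = ⊥-elim (n≮n m a<m)
commonNeighbour-consecutive (s≤s ()) _ first→last same
commonNeighbour-consecutive (s≤s (s≤s ())) _ first→last successor

module Junctions {n} (G : Graph n) {m} (C : Fin (suc m) → Subset n)
  (cliques : ∀ i → IsClique G (C i))
  (covers : ∀ u v → Adj G u v → ∃[ i ] (u ∈ C i × v ∈ C i))
  (consecutive : ∀ i j → toℕ j ≡ suc (toℕ i) → Nonempty (C i ∩ C j))
  (disjoint : ∀ i j → i ≢ j → ¬ CycNext G i j → ¬ CycNext G j i → Empty (C i ∩ C j))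
  (3≤m : 3 ≤ m)
  where

  cycNext? : ∀ (i j : Fin (suc m)) → Dec (CycNext G i j)
  cycNext? i j = (toℕ j ≟ℕ suc (toℕ i)) ⊎-dec ((toℕ i ≟ℕ m) ×-dec (toℕ j ≟ℕ 0))

  cycNext⇒cyclicNeighbours : ∀ {i j : Fin (suc m)} → CycNext G i j → CyclicNeighbours m (toℕ i) (toℕ j)
  cycNext⇒cyclicNeighbours (inj₁ j≡1+i) rewrite j≡1+i = successor
  cycNext⇒cyclicNeighbours (inj₂ (i≡m , j≡0)) rewrite i≡m | j≡0 = last→first

  sharedVertex-cyclicNeighbours : ∀ {v i j} → v ∈ C i → v ∈ C j → CyclicNeighbours m (toℕ i) (toℕ j)
  sharedVertex-cyclicNeighbours {v} {i} {j} v∈i v∈j with i ≟F j | cycNext? i j | cycNext? j i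
  ... | yes refl | _        | _        = same
  ... | no _     | yes i→j  | _        = cycNext⇒cyclicNeighbours i→j
  ... | no _     | no _     | yes j→i  = cyclicNeighbours-sym (cycNext⇒cyclicNeighbours j→i)
  ... | no i≢j   | no ¬i→j  | no ¬j→i  = ⊥-elim (disjoint i j i≢j ¬i→j ¬j→i (v , x∈p∩q⁺ (v∈i , v∈j)))

  junction-shared : ∀ (a : Fin m) → Nonempty (C (inject₁ a) ∩ C (fsuc a))
  junction-shared a = consecutive (inject₁ a) (fsuc a) (cong suc (sym (toℕ-inject₁ a)))

  junction : Fin m → Fin n
  junction a = proj₁ (junction-shared a)

  junction-∈ : ∀ a → junction a ∈ C (inject₁ a) × junction a ∈ C (fsuc a)
  junction-∈ a = x∈p∩q⁻ (C (inject₁ a)) (C (fsuc a)) (proj₂ (junction-shared a))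

  junction-cliques : ∀ {a t} → junction a ∈ C t → toℕ a ≤ toℕ t × toℕ t ≤ suc (toℕ a)
  junction-cliques {a} {t} x∈t = commonNeighbour-consecutive 3≤m (toℕ<n a)
    (subst (λ i → CyclicNeighbours m i (toℕ t)) (toℕ-inject₁ a)
      (sharedVertex-cyclicNeighbours (proj₁ (junction-∈ a)) x∈t))
    (sharedVertex-cyclicNeighbours (proj₂ (junction-∈ a)) x∈t)

  junction-≤ : ∀ {a b} → junction a ≡ junction b → toℕ a ≤ toℕ b
  junction-≤ {a} {b} xa≡xb = ≤-trans
    (proj₁ (junction-cliques (subst (_∈ C (inject₁ b)) (sym xa≡xb) (proj₁ (junction-∈ b)))))
    (≤-reflexive (toℕ-inject₁ b))

  junction-injective : Injective _≡_ _≡_ junction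
  junction-injective xa≡xb = toℕ-injective (≤-antisym (junction-≤ xa≡xb) (junction-≤ (sym xa≡xb)))

  junctions-isInducedPath : IsInducedPath G junction
  junctions-isInducedPath = record
    { injective = junction-injective
    ; adjacent  = adjacent
    ; chordless = chordless
    }
    where
    adjacent : ∀ {a b} → toℕ b ≡ suc (toℕ a) → Adj G (junction a) (junction b)
    adjacent {a} {b} b≡1+a = cliques (fsuc a) _ _ (proj₂ (junction-∈ a))
      (subst (λ i → junction b ∈ C i) (toℕ-injective (trans (toℕ-inject₁ b) b≡1+a))
        (proj₁ (junction-∈ b)))
      (λ xa≡xb → n≮n (toℕ a) (≤-trans (≤-reflexive (sym b≡1+a)) (junction-≤ (sym xa≡xb))))
    chordless : ∀ {a b} → 2 + toℕ a ≤ toℕ b → ¬ Adj G (junction a) (junction b)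
    chordless {a} {b} 2+a≤b xa~xb with covers _ _ xa~xb
    ... | t , xa∈t , xb∈t = n≮n (suc (toℕ a))
      (≤-trans 2+a≤b (≤-trans (proj₁ (junction-cliques xb∈t)) (proj₂ (junction-cliques xa∈t))))

module _ {n} (G : Graph n) where

  IsCC-suc⇒edgePath : ∀ {k} → IsCC G (suc k) → ∃ (IsInducedPath G {2})
  IsCC-suc⇒edgePath ((_ , covering) , minimal)
    with cliqueCovering-edge G covering (λ covering₀ → case minimal 0 (λ ()) covering₀ of λ ())
  ... | _ , _ , uv = _ , edge-isInducedPath G uv

  cycleOfCliques-inducedPath : IsCycleOfCliques G →
    ∃[ m ] (∃ (IsCliqueCovering G (suc m)) × ∃[ p ] (m ≤ suc p × ∃ (IsInducedPath G {suc p})))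
  cycleOfCliques-inducedPath
    (m@(suc (suc (suc _))) , C , (_ , (cliques , covers) , _) , consecutive , _ , disjoint) =
      m , (C , cliques , covers) , _ , ≤-refl , _ , junctions-isInducedPath
    where open Junctions G C cliques covers consecutive disjoint (s≤s (s≤s (s≤s z≤n)))
  cycleOfCliques-inducedPath (0 , C , (cc , covering , _) , _) =
    0 , (C , covering) , 1 , z≤n , IsCC-suc⇒edgePath cc
  cycleOfCliques-inducedPath (1 , C , (cc , covering , _) , _) =
    1 , (C , covering) , 1 , s≤s z≤n , IsCC-suc⇒edgePath cc
  cycleOfCliques-inducedPath (2 , C , (cc , covering , _) , _) =
    2 , (C , covering) , 1 , s≤s (s≤s z≤n) , IsCC-suc⇒edgePath cc

theorem11p5 : (n : ℕ) (G : Graph n) → IsCycleOfCliques G →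
    (z k : ℕ) → IsZplus G z → IsCC G k → z + k ≤ n + 2
theorem11p5 n G cycle z k (_ , z-minimal) (_ , k-minimal)
  with cycleOfCliques-inducedPath G cycle
... | m , (C , covering) , p , m≤1+p , x , path
  with inducedPath-zeroForcing G path
... | forcing , size = begin
  z + k                 ≤⟨ +-mono-≤ (z-minimal S forcing) (k-minimal (suc m) C covering) ⟩
  ∣ S ∣ + suc m         ≤⟨ +-monoʳ-≤ ∣ S ∣ (s≤s m≤1+p) ⟩
  ∣ S ∣ + suc (suc p)   ≡⟨ trans (+-suc ∣ S ∣ (suc p)) (cong suc (+-suc ∣ S ∣ p)) ⟩
  2 + (∣ S ∣ + p)       ≡⟨ cong (2 +_) size ⟩
  2 + n                 ≡⟨ +-comm 2 n ⟩
  n + 2                 ∎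
  where
  open ≤-Reasoning
  S : Subset n
  S = ∁ (image (x ∘ fsuc))
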